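{- Let $q$ be a prime power and let $\mathcal V=\{V_1,\dots,V_k\}$ be a mixed spread of strength 2 of subspaces of $GF(q)^n$, with associated geometric orthogonal array $OA(\mathcal V)$. Then $OA(\mathcal V)$ can be extended, by appending some number $l\ge0$ of further columns each with $q$ levels, to an orthogonal array of strength 2 with $q^n$ runs that is tight, i.e. satisfies $\sum_{i=1}^k (q^{\dim V_i}-1)+l(q-1)=q^n-1$.
   Context: A collection $\mathcal V=\{V_1,\dots,V_k\}$ of subspaces of $GF(q)^n$ is a mixed spread of strength 2 if $V_i\cap V_j=\{0\}$ for all $i\ne j$. For each $i$ fix a labeling of the dual space $V_i^*$ by $\{0,\dots,q^{\dim V_i}-1\}$. The array $OA(\mathcal V)$ has $q^n$ rows indexed by the linear functionals $f$ on $GF(q)^n$ and columns indexed by $V_1,\dots,V_k$, the $(f,V_i)$ entry being the label of $f|_{V_i}$; it is an orthogonal array of strength 2, i.e. in every pair of columns each possible ordered pair of symbols occurs equally often. An array with $N$ runs and columns with $s_1,\ldots,s_k$ levels is tight if $\sum_i (s_i-1)=N-1$ (equality in the Rao bound). -}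

module Defs where

open import Data.Nat using (ℕ; zero; suc; _∸_; _^_)
open import Data.Fin using (Fin; _≟_)
open import Data.Vec using (Vec; []; _∷_; replicate; map; foldr; zipWith)
import Data.List as L
open import Data.List using (List; length; filter; concatMap)
open import Data.Nat.ListAction using (sum)
open import Data.Product using (Σ; _×_; _,_; proj₁; proj₂)
open import Relation.Binary.PropositionalEquality using (_≡_; _≢_)
open import Relation.Nullary using (¬_)
open import Relation.Nullary.Decidable using (_×-dec_)
open import Algebra.Structures using (IsCommutativeRing)
open import Function.Bundles using (_↔_; Inverse)

-- A finite field with q elements, whose carrier is Fin q
-- (every finite field is GF(q) for a prime power q, and vice versa).
record FiniteField (q : ℕ) : Set where
  infixl 6 _+_
  infixl 7 _*_
  field
    _+_ _*_ : Fin q → Fin q → Fin q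
    -_      : Fin q → Fin q
    0# 1#   : Fin q
    isCommutativeRing : IsCommutativeRing _≡_ _+_ _*_ -_ 0# 1#
    0≢1     : 0# ≢ 1#
    inverse : ∀ x → x ≢ 0# → Σ (Fin q) λ y → x * y ≡ 1#

module _ {q : ℕ} (F : FiniteField q) where
  open FiniteField F

  zeroV : (n : ℕ) → Vec (Fin q) n
  zeroV n = replicate n 0#

  dot : ∀ {n} → Vec (Fin q) n → Vec (Fin q) n → Fin q
  dot a x = foldr _ _+_ 0# (zipWith _*_ a x)

  lincomb : ∀ {n d} → Vec (Fin q) d → Vec (Vec (Fin q) n) d → Vec (Fin q) n
  lincomb {n} []       []       = zeroV n
  lincomb     (c ∷ cs) (b ∷ bs) = zipWith _+_ (map (c *_) b) (lincomb cs bs)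

  LinIndep : ∀ {n d} → Vec (Vec (Fin q) n) d → Set
  LinIndep {n} {d} B = ∀ (c : Vec (Fin q) d) → lincomb c B ≡ zeroV n → c ≡ zeroV d

  -- Subspaces V_i = span(B i), each given by a basis B i of size d i = dim V_i.
  -- Mixed spread of strength 2: V_i ∩ V_j = {0} for i ≠ j.
  MixedSpread : ∀ {n k} (d : Fin k → ℕ) → ((i : Fin k) → Vec (Vec (Fin q) n) (d i)) → Set
  MixedSpread {n} {k} d B =
    ∀ (i j : Fin k) → i ≢ j →
    ∀ (c : Vec (Fin q) (d i)) (c′ : Vec (Fin q) (d j)) →
    lincomb c (B i) ≡ lincomb c′ (B j) → lincomb c (B i) ≡ zeroV n

  -- all vectors of GF(q)^n (each exactly once); these index the linear functionals
  allVecs : (n : ℕ) → List (Vec (Fin q) n)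
  allVecs zero    = L.[ [] ]
  allVecs (suc n) = concatMap (λ x → L.map (x ∷_) (allVecs n)) (allFinList q)
    where
    allFinList : (m : ℕ) → List (Fin m)
    allFinList m = Data.List.tabulate (λ i → i)

Column : Set → Set
Column R = Σ ℕ λ s → R → Fin s

module _ {R : Set} (rows : List R) where

  IsOA2 : List (Column R) → Set
  IsOA2 cs =
    ∀ (i j : Fin (length cs)) → i ≢ j →
    let ci = L.lookup cs i ; cj = L.lookup cs j in
    ∀ (a a′ : Fin (proj₁ ci)) (b b′ : Fin (proj₁ cj)) →
    length (filter (λ r → (proj₂ ci r ≟ a) ×-dec (proj₂ cj r ≟ b)) rows)
      ≡ length (filter (λ r → (proj₂ ci r ≟ a′) ×-dec (proj₂ cj r ≟ b′)) rows)

Tight : {R : Set} → ℕ → List (Column R) → Set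
Tight N cs = sum (L.map (λ c → proj₁ c ∸ 1) cs) ≡ N ∸ 1

module _ {q : ℕ} (F : FiniteField q) where

  -- the geometric array OA(V): row f_a (a ∈ GF(q)^n), column V_i, entry = label of f_a|V_i,
  -- where f_a|V_i ∈ V_i^* is represented by its values (f_a(b_1),...,f_a(b_d)) on the basis,
  -- and ℓ i is the chosen labeling of V_i^* by {0,…,q^(dim V_i) - 1}.
  geomOA : ∀ n k (d : Fin k → ℕ) (B : (i : Fin k) → Vec (Vec (Fin q) n) (d i))
           (ℓ : (i : Fin k) → Vec (Fin q) (d i) ↔ Fin (q ^ d i)) →
           List (Column (Vec (Fin q) n))
  geomOA n k d B ℓ =
    L.map (λ i → (q ^ d i) , (λ a → Inverse.to (ℓ i) (map (dot F a) (B i))))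
          (Data.List.tabulate {n = k} (λ i → i))

module Submission where

-- The nonzero vectors lying in no V_i fall into projective points ⟨w⟩, each with a unique monic
-- representative w, and the appended q-level columns are the functionals f ↦ f(w) for these points.
-- Together with the V_i they form a mixed spread whose subspaces partition GF(q)^n ∖ {0}.
-- The array of any mixed spread has strength 2: if C ++ C′ is linearly independent, restricting
-- functionals to C ++ C′ is onto, so all its fibres have the same size. Counting the nonzero
-- vectors subspace by subspace gives Σ (q^dim − 1) = q^n − 1, which is tightness.

open import Defs
open import Data.Nat using (ℕ; _^_)
open import Data.Fin using (Fin)
open import Data.Vec using (Vec)
open import Data.Product using (Σ; _×_; _,_)
open import Function.Bundles using (_↔_)

module Counting where
  open import Data.Bool using (if_then_else_)
  open import Data.Nat using (ℕ; suc; _+_; _*_)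
  open import Data.Nat.Properties using (+-suc; +-commutativeSemigroup)
  open import Data.Nat.ListAction using (sum)
  open import Data.List using (List; []; _∷_; _++_; length; filter; map; concatMap; cartesianProductWith; allFin)
  open import Data.List.Properties using (length-++; length-map; filter-≐; filter-none; filter-all; map-cong)
  open import Data.List.Membership.Propositional using (_∈_)
  open import Data.List.Membership.Propositional.Properties using (∈-allFin)
  open import Data.List.Relation.Unary.All as All using (All; []; _∷_)
  open import Data.List.Relation.Unary.Any as Any using (Any; here; there; any?)
  open import Data.List.Relation.Unary.AllPairs as AllPairs using (AllPairs; []; _∷_)
  open import Data.List.Relation.Unary.Unique.Propositional using (Unique)
  open import Data.List.Relation.Unary.Unique.Propositional.Properties using (allFin⁺)
  open import Data.Product using (∃; _×_; _,_; proj₁; proj₂)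
  open import Function using (_∘_)
  open import Function.Bundles using (_↔_; Inverse; Injection)
  open import Function.Properties.Inverse using (↔⇒↣)
  open import Level using (0ℓ)
  open import Relation.Binary.Definitions using (DecidableEquality)
  open import Relation.Binary.PropositionalEquality
    using (_≡_; refl; sym; trans; cong; cong₂; subst; module ≡-Reasoning)
  open import Relation.Nullary using (¬_; Dec; yes; no; does; contradiction)
  open import Relation.Nullary.Decidable using (_×-dec_)
  open import Relation.Unary using (Pred; Decidable; _≐_; ∁)
  open import Relation.Unary.Properties using (∁?; _∩?_; U?)
  open import Algebra.Properties.CommutativeSemigroup +-commutativeSemigroup using (interchange)

  count : {A : Set} {P : Pred A 0ℓ} → Decidable P → List A → ℕ
  count P? xs = length (filter P? xs)

  indicator : {P : Set} → Dec P → ℕ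
  indicator P? = if does P? then 1 else 0

  sum-map-+ : {A : Set} (f g : A → ℕ) (xs : List A) →
              sum (map (λ x → f x + g x) xs) ≡ sum (map f xs) + sum (map g xs)
  sum-map-+ f g []       = refl
  sum-map-+ f g (x ∷ xs) =
    trans (cong (f x + g x +_) (sum-map-+ f g xs)) (interchange (f x) (g x) _ _)

  sum-map-0 : {A : Set} (xs : List A) → sum (map (λ _ → 0) xs) ≡ 0
  sum-map-0 []       = refl
  sum-map-0 (_ ∷ xs) = sum-map-0 xs

  module _ {A : Set} {P : Pred A 0ℓ} (P? : Decidable P) where

    count-∷ : ∀ x xs → count P? (x ∷ xs) ≡ indicator (P? x) + count P? xs
    count-∷ x xs with P? x
    ... | yes _ = refl
    ... | no  _ = refl

    count≡sum : ∀ xs → count P? xs ≡ sum (map (indicator ∘ P?) xs)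
    count≡sum []       = refl
    count≡sum (x ∷ xs) = trans (count-∷ x xs) (cong (indicator (P? x) +_) (count≡sum xs))

    count+count-∁ : ∀ xs → count P? xs + count (∁? P?) xs ≡ length xs
    count+count-∁ []       = refl
    count+count-∁ (x ∷ xs) with P? x
    ... | yes _ = cong suc (count+count-∁ xs)
    ... | no  _ = trans (+-suc (count P? xs) _) (cong suc (count+count-∁ xs))

    count-none : ∀ {xs} → All (∁ P) xs → count P? xs ≡ 0
    count-none ¬Ps = cong length (filter-none P? ¬Ps)

    count-one : ∀ {xs} → Any P xs → AllPairs (λ x y → ¬ (P x × P y)) xs → count P? xs ≡ 1
    count-one {x ∷ xs} (here px) (excl ∷ _) with P? x
    ... | yes _  = cong suc (count-none (All.map (λ e py → e (px , py)) excl))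
    ... | no ¬px = contradiction px ¬px
    count-one {x ∷ xs} (there any) (excl ∷ excls) with P? x
    ... | yes px = contradiction (px , proj₂ (All.lookupAny excl any)) (proj₁ (All.lookupAny excl any))
    ... | no  _  = count-one any excls

  module _ {A : Set} {P Q : Pred A 0ℓ} (P? : Decidable P) (Q? : Decidable Q) where

    count-≐ : P ≐ Q → ∀ xs → count P? xs ≡ count Q? xs
    count-≐ P≐Q xs = cong length (filter-≐ P? Q? P≐Q xs)

  double-count : {A B : Set} {P : Pred A 0ℓ} {R : A → B → Set}
                 (P? : Decidable P) (R? : ∀ x y → Dec (R x y)) (ys : List B) →
                 (∀ {x} → P x → count (R? x) ys ≡ 1) →
                 ∀ xs → count P? xs ≡ sum (map (λ y → count (P? ∩? λ x → R? x y) xs) ys)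
  double-count P? R? ys exactly-one []       = sym (sum-map-0 ys)
  double-count {P = P} P? R? ys exactly-one (x ∷ xs) = begin
    count P? (x ∷ xs)
      ≡⟨ count-∷ P? x xs ⟩
    indicator (P? x) + count P? xs
      ≡⟨ cong₂ _+_ (split (P? x)) (double-count P? R? ys exactly-one xs) ⟩
    sum (map (λ y → indicator ((P? ∩? λ x → R? x y) x)) ys)
      + sum (map (λ y → count (P? ∩? λ x → R? x y) xs) ys)
      ≡⟨ sum-map-+ _ _ ys ⟨
    sum (map (λ y → indicator ((P? ∩? λ x → R? x y) x) + count (P? ∩? λ x → R? x y) xs) ys)
      ≡⟨ cong sum (map-cong (λ y → count-∷ (P? ∩? λ x → R? x y) x xs) ys) ⟨
    sum (map (λ y → count (P? ∩? λ x → R? x y) (x ∷ xs)) ys) ∎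
    where
    open ≡-Reasoning
    split : (p : Dec (P x)) → indicator p ≡ sum (map (λ y → indicator (p ×-dec R? x y)) ys)
    split (yes px) = trans (sym (exactly-one px)) (count≡sum (R? x) ys)
    split (no _)   = sym (sum-map-0 ys)

  record Enumeration {A : Set} (xs : List A) : Set where
    field
      unique   : Unique xs
      complete : ∀ a → a ∈ xs

  module _ {A : Set} {xs : List A} (enum : Enumeration xs) where
    open Enumeration enum

    count-unique : ∀ {P : Pred A 0ℓ} (P? : Decidable P) {a} → P a → (∀ {b} → P b → b ≡ a) →
                   count P? xs ≡ 1
    count-unique P? {a} pa unique-a = count-one P? (Any.map (λ { refl → pa }) (complete a))
      (AllPairs.map (λ x≢y (px , py) → x≢y (trans (unique-a px) (sym (unique-a py)))) unique)

    search : ∀ {P : Pred A 0ℓ} → Decidable P → Dec (∃ P)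
    search P? with any? P? xs
    ... | yes any = yes (Any.satisfied any)
    ... | no ¬any = no λ (a , pa) → ¬any (Any.map (λ { refl → pa }) (complete a))

  module _ {A B : Set} {xs : List A} {ys : List B} (enumA : Enumeration xs) (enumB : Enumeration ys)
           (_≟_ : DecidableEquality B) {P : Pred A 0ℓ} {Q : Pred B 0ℓ}
           (P? : Decidable P) (Q? : Decidable Q) (f : A → B) where

    count-bijection : (∀ {x} → P x → Q (f x)) →
                      (∀ {x x′} → P x → P x′ → f x ≡ f x′ → x ≡ x′) →
                      (∀ {y} → Q y → ∃ λ x → P x × f x ≡ y) →
                      count P? xs ≡ count Q? ys
    count-bijection maps injective surjective = begin
      count P? xs
        ≡⟨ double-count P? (λ x y → f x ≟ y) ys (λ _ → count-unique enumB (f _ ≟_) refl sym) xs ⟩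
      sum (map (λ y → count (P? ∩? λ x → f x ≟ y) xs) ys)
        ≡⟨ cong sum (map-cong fibre ys) ⟩
      sum (map (indicator ∘ Q?) ys)
        ≡⟨ count≡sum Q? ys ⟨
      count Q? ys ∎
      where
      open ≡-Reasoning
      fibre : ∀ y → count (P? ∩? λ x → f x ≟ y) xs ≡ indicator (Q? y)
      fibre y with Q? y
      ... | yes qy = let (x , px , fx≡y) = surjective qy in
        count-unique enumA (P? ∩? λ x → f x ≟ y) (px , fx≡y)
          (λ (px′ , fx′≡y) → injective px′ px (trans fx′≡y (sym fx≡y)))
      ... | no ¬qy = count-none (P? ∩? λ x → f x ≟ y)
          (All.universal (λ x (px , fx≡y) → ¬qy (subst Q fx≡y (maps px))) xs)

  AllPairs-mapWithAll : {A : Set} {P : Pred A 0ℓ} {R S : A → A → Set} →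
                        (∀ {x y} → P x → P y → R x y → S x y) →
                        ∀ {xs} → All P xs → AllPairs R xs → AllPairs S xs
  AllPairs-mapWithAll f []         []         = []
  AllPairs-mapWithAll f (px ∷ pxs) (rx ∷ rxs) =
    All.zipWith (λ (py , r) → f px py r) (pxs , rx) ∷ AllPairs-mapWithAll f pxs rxs

  length-↔ : {A B : Set} {xs : List A} {ys : List B} → Enumeration xs → Enumeration ys →
             DecidableEquality B → A ↔ B → length xs ≡ length ys
  length-↔ {xs = xs} {ys} enumA enumB _≟_ A↔B = begin
    length xs    ≡⟨ cong length (filter-all U? (All.universal _ xs)) ⟨
    count U? xs  ≡⟨ count-bijection enumA enumB _≟_ U? U? to _ (λ _ _ → Injection.injective (↔⇒↣ A↔B))
                      (λ {y} _ → from y , _ , strictlyInverseˡ y) ⟩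
    count U? ys  ≡⟨ cong length (filter-all U? (All.universal _ ys)) ⟩
    length ys    ∎
    where
    open ≡-Reasoning
    open Inverse A↔B

  concatMap-map≡cartesianProductWith : {A B C : Set} (f : A → B → C) (xs : List A) (ys : List B) →
    concatMap (λ x → map (f x) ys) xs ≡ cartesianProductWith f xs ys
  concatMap-map≡cartesianProductWith f []       ys = refl
  concatMap-map≡cartesianProductWith f (x ∷ xs) ys =
    cong (map (f x) ys ++_) (concatMap-map≡cartesianProductWith f xs ys)

  length-cartesianProductWith : {A B C : Set} (f : A → B → C) (xs : List A) (ys : List B) →
    length (cartesianProductWith f xs ys) ≡ length xs * length ys
  length-cartesianProductWith f []       ys = refl
  length-cartesianProductWith f (x ∷ xs) ys = begin
    length (map (f x) ys ++ cartesianProductWith f xs ys) ≡⟨ length-++ (map (f x) ys) ⟩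
    length (map (f x) ys) + length (cartesianProductWith f xs ys)
      ≡⟨ cong₂ _+_ (length-map (f x) ys) (length-cartesianProductWith f xs ys) ⟩
    length ys + length xs * length ys ∎
    where open ≡-Reasoning

  allFin-enumeration : ∀ k → Enumeration (allFin k)
  allFin-enumeration k = record { unique = allFin⁺ k ; complete = ∈-allFin }

module OrthogonalArrays where
  open import Data.Fin as Fin using (Fin) renaming (_≟_ to _≟ᶠ_)
  open import Data.List using (List)
  open import Data.List.Membership.Propositional.Properties using (∈-lookup)
  open import Data.List.Relation.Unary.All as All using ()
  open import Data.List.Relation.Unary.AllPairs using (AllPairs; _∷_)
  open import Data.Product using (_,_; proj₁; proj₂)
  open import Function using (_∘_)
  open import Relation.Binary.PropositionalEquality using (_≡_; refl; sym; trans; cong)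
  open import Relation.Nullary using (contradiction)
  open import Relation.Nullary.Decidable using (_×-dec_)
  open Counting

  module _ {R : Set} (rows : List R) where

    Balanced : Column R → Column R → Set
    Balanced c c′ = ∀ (a a′ : Fin (proj₁ c)) (b b′ : Fin (proj₁ c′)) →
      count (λ r → (proj₂ c r ≟ᶠ a) ×-dec (proj₂ c′ r ≟ᶠ b)) rows
        ≡ count (λ r → (proj₂ c r ≟ᶠ a′) ×-dec (proj₂ c′ r ≟ᶠ b′)) rows

    Balanced-sym : ∀ {c c′} → Balanced c c′ → Balanced c′ c
    Balanced-sym {c} {c′} balanced a a′ b b′ =
      trans (swap a b) (trans (balanced b b′ a a′) (sym (swap a′ b′)))
      where
      swap : ∀ a b → count (λ r → (proj₂ c′ r ≟ᶠ a) ×-dec (proj₂ c r ≟ᶠ b)) rows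
                   ≡ count (λ r → (proj₂ c r ≟ᶠ b) ×-dec (proj₂ c′ r ≟ᶠ a)) rows
      swap a b = count-≐ _ _ ((λ (e , e′) → e′ , e) , (λ (e , e′) → e′ , e)) rows

    isOA2 : ∀ {cs} → AllPairs Balanced cs → IsOA2 rows cs
    isOA2 (b ∷ bs) Fin.zero    Fin.zero    i≢j = contradiction refl i≢j
    isOA2 (b ∷ bs) Fin.zero    (Fin.suc j) _   = All.lookup b (∈-lookup j)
    isOA2 (b ∷ bs) (Fin.suc i) Fin.zero    _   = Balanced-sym (All.lookup b (∈-lookup i))
    isOA2 (b ∷ bs) (Fin.suc i) (Fin.suc j) i≢j = isOA2 bs i j (i≢j ∘ cong Fin.suc)

module Linear {q : ℕ} (F : FiniteField q) where
  open import Algebra.Bundles using (CommutativeRing; AbelianGroup)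
  open import Data.Fin using (Fin) renaming (_≟_ to _≟ᶠ_)
  open import Data.List using (length; cartesianProductWith; allFin)
  open import Data.List.Properties using (length-tabulate)
  open import Data.List.Membership.Propositional using (_∈_)
  open import Data.List.Membership.Propositional.Properties using (∈-cartesianProductWith⁺; ∈-allFin)
  import Data.List.Relation.Unary.All as All
  import Data.List.Relation.Unary.AllPairs as AllPairs
  import Data.List.Relation.Unary.Any as Any
  open import Data.List.Relation.Unary.Unique.Propositional using (Unique)
  open import Data.List.Relation.Unary.Unique.Propositional.Properties using (cartesianProductWith⁺; allFin⁺)
  open import Data.Nat using (ℕ; zero; suc; _^_) renaming (_*_ to _*ℕ_)
  open import Data.Product using (∃; _,_; proj₁; proj₂)
  open import Data.Vec using (Vec; []; _∷_; map; zipWith; _++_; splitAt)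
  open import Data.Vec.Properties using (∷-injective; ∷-injectiveˡ; ∷-injectiveʳ; ≡-dec; map-∘; map-cong; map-id;
    zipWith-assoc; zipWith-comm; zipWith-identityˡ; zipWith-identityʳ; zipWith-inverseˡ; zipWith-inverseʳ)
  open import Function using (_∘_; id)
  open import Level using (0ℓ)
  open import Relation.Binary.Definitions using (DecidableEquality)
  open import Relation.Binary.PropositionalEquality
    using (_≡_; _≢_; refl; sym; trans; cong; cong₂; subst; isEquivalence; module ≡-Reasoning)
  open import Relation.Nullary using (¬_; Dec; yes; no; contradiction)
  open import Relation.Nullary.Decidable using (_×-dec_; ¬?; decidable-stable)
  open Counting
  open FiniteField F using (_+_; _*_; -_; 0#; 1#; isCommutativeRing; 0≢1; inverse)

  commutativeRing : CommutativeRing 0ℓ 0ℓ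
  commutativeRing = record { isCommutativeRing = isCommutativeRing }

  open CommutativeRing commutativeRing using (+-assoc; +-comm; +-identityˡ; +-identityʳ; -‿inverseˡ; -‿inverseʳ;
    *-assoc; *-comm; *-identityˡ; *-identityʳ; distribˡ; distribʳ; zeroˡ; zeroʳ;
    +-abelianGroup; +-commutativeSemigroup; ring)
  open import Algebra.Properties.Ring ring using (-‿distribˡ-*; -1*x≈-x; -‿involutive; -0#≈0#)
  open import Algebra.Properties.AbelianGroup +-abelianGroup using (⁻¹-∙-comm; x∙y⁻¹≈ε⇒x≈y; \\-leftDividesˡ)
  open import Algebra.Properties.CommutativeSemigroup +-commutativeSemigroup using (interchange)

  V : ℕ → Set
  V = Vec (Fin q)

  infixl 6 _+ᵛ_
  infixr 7 _·_
  infix 4 _≟ᵛ_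

  _+ᵛ_ : ∀ {n} → V n → V n → V n
  _+ᵛ_ = zipWith _+_

  -ᵛ_ : ∀ {n} → V n → V n
  -ᵛ_ = map -_

  0ᵛ : ∀ {n} → V n
  0ᵛ {n} = zeroV F n

  _·_ : ∀ {n} → Fin q → V n → V n
  t · v = map (t *_) v

  _≟ᵛ_ : ∀ {n} → DecidableEquality (V n)
  _≟ᵛ_ = ≡-dec _≟ᶠ_

  allVecs≡cartesianProductWith : ∀ n →
    allVecs F (suc n) ≡ cartesianProductWith _∷_ (allFin q) (allVecs F n)
  allVecs≡cartesianProductWith n = concatMap-map≡cartesianProductWith _∷_ (allFin q) (allVecs F n)

  allVecs-enumeration : ∀ n → Enumeration (allVecs F n)
  allVecs-enumeration zero    =
    record { unique = All.[] AllPairs.∷ AllPairs.[] ; complete = λ { [] → Any.here refl } }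
  allVecs-enumeration (suc n) = record
    { unique   = subst Unique (sym (allVecs≡cartesianProductWith n))
                   (cartesianProductWith⁺ _∷_ ∷-injective (allFin⁺ q) unique)
    ; complete = λ { (x ∷ v) → subst ((x ∷ v) ∈_) (sym (allVecs≡cartesianProductWith n))
                   (∈-cartesianProductWith⁺ _∷_ (∈-allFin x) (complete v)) } }
    where open Enumeration (allVecs-enumeration n)

  length-allVecs : ∀ n → length (allVecs F n) ≡ q ^ n
  length-allVecs zero    = refl
  length-allVecs (suc n) = begin
    length (allVecs F (suc n))
      ≡⟨ cong length (allVecs≡cartesianProductWith n) ⟩
    length (cartesianProductWith _∷_ (allFin q) (allVecs F n))
      ≡⟨ length-cartesianProductWith _∷_ (allFin q) (allVecs F n) ⟩
    length (allFin q) *ℕ length (allVecs F n)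
      ≡⟨ cong₂ _*ℕ_ (length-tabulate {n = q} id) (length-allVecs n) ⟩
    q *ℕ q ^ n ∎
    where open ≡-Reasoning

  +ᵛ-abelianGroup : ℕ → AbelianGroup 0ℓ 0ℓ
  +ᵛ-abelianGroup n = record
    { Carrier = V n ; _≈_ = _≡_ ; _∙_ = _+ᵛ_ ; ε = 0ᵛ ; _⁻¹ = -ᵛ_
    ; isAbelianGroup = record
      { isGroup = record
        { isMonoid = record
          { isSemigroup = record
            { isMagma = record { isEquivalence = isEquivalence ; ∙-cong = cong₂ _+ᵛ_ }
            ; assoc = zipWith-assoc +-assoc }
          ; identity = zipWith-identityˡ +-identityˡ , zipWith-identityʳ +-identityʳ }
        ; inverse = zipWith-inverseˡ -‿inverseˡ , zipWith-inverseʳ -‿inverseʳ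
        ; ⁻¹-cong = cong -ᵛ_ }
      ; comm = zipWith-comm +-comm } }

  module +ᵛ {n : ℕ} where
    open AbelianGroup (+ᵛ-abelianGroup n) public
      using (assoc; identityˡ; identityʳ; inverseˡ; inverseʳ; commutativeSemigroup)
    open import Algebra.Properties.AbelianGroup (+ᵛ-abelianGroup n) public
      using (inverseˡ-unique; x∙y⁻¹≈ε⇒x≈y; ∙-cancelʳ; //-rightDividesˡ)
    open import Algebra.Properties.CommutativeSemigroup commutativeSemigroup public using (interchange)

  ·-distribˡ : ∀ {n} t (u v : V n) → t · (u +ᵛ v) ≡ t · u +ᵛ t · v
  ·-distribˡ t []       []       = refl
  ·-distribˡ t (x ∷ u) (y ∷ v) = cong₂ _∷_ (distribˡ t x y) (·-distribˡ t u v)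

  ·-distribʳ : ∀ {n} s t (v : V n) → (s + t) · v ≡ s · v +ᵛ t · v
  ·-distribʳ s t []      = refl
  ·-distribʳ s t (x ∷ v) = cong₂ _∷_ (distribʳ x s t) (·-distribʳ s t v)

  ·-assoc : ∀ {n} s t (v : V n) → s · t · v ≡ (s * t) · v
  ·-assoc s t v = trans (sym (map-∘ (s *_) (t *_) v)) (map-cong (λ x → sym (*-assoc s t x)) v)

  ·-identityˡ : ∀ {n} (v : V n) → 1# · v ≡ v
  ·-identityˡ v = trans (map-cong *-identityˡ v) (map-id v)

  ·-zeroˡ : ∀ {n} (v : V n) → 0# · v ≡ 0ᵛ
  ·-zeroˡ []      = refl
  ·-zeroˡ (x ∷ v) = cong₂ _∷_ (zeroˡ x) (·-zeroˡ v)

  ·-zeroʳ : ∀ {n} t → t · 0ᵛ {n} ≡ 0ᵛ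
  ·-zeroʳ {zero}  t = refl
  ·-zeroʳ {suc n} t = cong₂ _∷_ (zeroʳ t) (·-zeroʳ t)

  -1·v≡-ᵛv : ∀ {n} (v : V n) → (- 1#) · v ≡ -ᵛ v
  -1·v≡-ᵛv v = map-cong -1*x≈-x v

  inv : (t : Fin q) → t ≢ 0# → Fin q
  inv t t≢0 = proj₁ (inverse t t≢0)

  inv-* : ∀ t (t≢0 : t ≢ 0#) → inv t t≢0 * t ≡ 1#
  inv-* t t≢0 = trans (*-comm _ t) (proj₂ (inverse t t≢0))

  ·-cancel : ∀ {n t} (t≢0 : t ≢ 0#) {u v : V n} → t · u ≡ v → u ≡ inv t t≢0 · v
  ·-cancel {t = t} t≢0 {u} {v} e = begin
    u                    ≡⟨ ·-identityˡ u ⟨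
    1# · u               ≡⟨ cong (_· u) (inv-* t t≢0) ⟨
    (inv t t≢0 * t) · u  ≡⟨ ·-assoc _ t u ⟨
    inv t t≢0 · t · u    ≡⟨ cong (inv t t≢0 ·_) e ⟩
    inv t t≢0 · v        ∎
    where open ≡-Reasoning

  -1≢0 : - 1# ≢ 0#
  -1≢0 -1≡0 = 0≢1 (sym (begin
    1#         ≡⟨ -‿involutive 1# ⟨
    - (- 1#)   ≡⟨ cong -_ -1≡0 ⟩
    - 0#       ≡⟨ -0#≈0# ⟩
    0#         ∎))
    where open ≡-Reasoning

  dot-+ˡ : ∀ {n} (a b c : V n) → dot F (a +ᵛ b) c ≡ dot F a c + dot F b c
  dot-+ˡ []      []      []      = sym (+-identityˡ 0#)
  dot-+ˡ (x ∷ a) (y ∷ b) (z ∷ c) =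
    trans (cong₂ _+_ (distribʳ z x y) (dot-+ˡ a b c)) (interchange _ _ _ _)

  dot-·ˡ : ∀ {n} t (a c : V n) → dot F (t · a) c ≡ t * dot F a c
  dot-·ˡ t []      []      = sym (zeroʳ t)
  dot-·ˡ t (x ∷ a) (z ∷ c) = trans (cong₂ _+_ (*-assoc t x z) (dot-·ˡ t a c)) (sym (distribˡ t _ _))

  dot-0ˡ : ∀ {n} (c : V n) → dot F 0ᵛ c ≡ 0#
  dot-0ˡ []      = refl
  dot-0ˡ (z ∷ c) = trans (cong₂ _+_ (zeroˡ z) (dot-0ˡ c)) (+-identityˡ 0#)

  dot-negˡ : ∀ {n} (a c : V n) → dot F (-ᵛ a) c ≡ - dot F a c
  dot-negˡ []      []      = sym -0#≈0#
  dot-negˡ (x ∷ a) (z ∷ c) = trans (cong₂ _+_ (sym (-‿distribˡ-* x z)) (dot-negˡ a c)) (⁻¹-∙-comm _ _)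

  dot-comm : ∀ {n} (a b : V n) → dot F a b ≡ dot F b a
  dot-comm []      []      = refl
  dot-comm (x ∷ a) (y ∷ b) = cong₂ _+_ (*-comm x y) (dot-comm a b)

  dot-lincomb : ∀ {n d} (z : V d) (S : Vec (V n) d) c →
                dot F (lincomb F z S) c ≡ dot F z (map (λ s → dot F s c) S)
  dot-lincomb []      []      c = dot-0ˡ c
  dot-lincomb (t ∷ z) (s ∷ S) c =
    trans (dot-+ˡ (t · s) (lincomb F z S) c) (cong₂ _+_ (dot-·ˡ t s c) (dot-lincomb z S c))

  dot-ext : ∀ {n} (v w : V n) → (∀ a → dot F a v ≡ dot F a w) → v ≡ w
  dot-ext []      []      _ = refl
  dot-ext (x ∷ v) (y ∷ w) h = cong₂ _∷_
    (trans (sym (unit x v)) (trans (h (1# ∷ 0ᵛ)) (unit y w)))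
    (dot-ext v w λ a → trans (sym (null x a v)) (trans (h (0# ∷ a)) (null y a w)))
    where
    unit : ∀ z u → 1# * z + dot F 0ᵛ u ≡ z
    unit z u = trans (cong₂ _+_ (*-identityˡ z) (dot-0ˡ u)) (+-identityʳ z)
    null : ∀ z a u → 0# * z + dot F a u ≡ dot F a u
    null z a u = trans (cong (_+ dot F a u) (zeroˡ z)) (+-identityˡ _)

  lincomb-0 : ∀ {n d} (S : Vec (V n) d) → lincomb F 0ᵛ S ≡ 0ᵛ
  lincomb-0 []      = refl
  lincomb-0 (s ∷ S) = trans (cong₂ _+ᵛ_ (·-zeroˡ s) (lincomb-0 S)) (+ᵛ.identityˡ _)

  lincomb-+ : ∀ {n d} (z w : V d) (S : Vec (V n) d) →
              lincomb F (z +ᵛ w) S ≡ lincomb F z S +ᵛ lincomb F w S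
  lincomb-+ []      []      []      = sym (+ᵛ.identityˡ _)
  lincomb-+ (x ∷ z) (y ∷ w) (s ∷ S) =
    trans (cong₂ _+ᵛ_ (·-distribʳ x y s) (lincomb-+ z w S)) (+ᵛ.interchange _ _ _ _)

  lincomb-· : ∀ {n d} t (z : V d) (S : Vec (V n) d) → lincomb F (t · z) S ≡ t · lincomb F z S
  lincomb-· t []      []      = sym (·-zeroʳ t)
  lincomb-· t (x ∷ z) (s ∷ S) =
    trans (cong₂ _+ᵛ_ (sym (·-assoc t x s)) (lincomb-· t z S)) (sym (·-distribˡ t _ _))

  lincomb-neg : ∀ {n d} (z : V d) (S : Vec (V n) d) → lincomb F (-ᵛ z) S ≡ -ᵛ lincomb F z S
  lincomb-neg z S = +ᵛ.inverseˡ-unique _ _ (begin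
    lincomb F (-ᵛ z) S +ᵛ lincomb F z S  ≡⟨ lincomb-+ (-ᵛ z) z S ⟨
    lincomb F (-ᵛ z +ᵛ z) S             ≡⟨ cong (λ c → lincomb F c S) (+ᵛ.inverseˡ z) ⟩
    lincomb F 0ᵛ S                      ≡⟨ lincomb-0 S ⟩
    0ᵛ                                  ∎)
    where open ≡-Reasoning

  lincomb-++ : ∀ {n d e} (z : V d) (w : V e) (S : Vec (V n) d) (T : Vec (V n) e) →
               lincomb F (z ++ w) (S ++ T) ≡ lincomb F z S +ᵛ lincomb F w T
  lincomb-++ []      w []      T = sym (+ᵛ.identityˡ _)
  lincomb-++ (x ∷ z) w (s ∷ S) T = trans (cong (x · s +ᵛ_) (lincomb-++ z w S T)) (sym (+ᵛ.assoc _ _ _))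

  restrict : ∀ {n m} → Vec (V n) m → V n → V m
  restrict C a = map (dot F a) C

  restrict-+ : ∀ {n m} (C : Vec (V n) m) a b → restrict C (a +ᵛ b) ≡ restrict C a +ᵛ restrict C b
  restrict-+ []      a b = refl
  restrict-+ (c ∷ C) a b = cong₂ _∷_ (dot-+ˡ a b c) (restrict-+ C a b)

  restrict-· : ∀ {n m} (C : Vec (V n) m) t a → restrict C (t · a) ≡ t · restrict C a
  restrict-· []      t a = refl
  restrict-· (c ∷ C) t a = cong₂ _∷_ (dot-·ˡ t a c) (restrict-· C t a)

  restrict-0 : ∀ {n m} (C : Vec (V n) m) → restrict C 0ᵛ ≡ 0ᵛ
  restrict-0 []      = refl
  restrict-0 (c ∷ C) = cong₂ _∷_ (dot-0ˡ c) (restrict-0 C)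

  restrict-neg : ∀ {n m} (C : Vec (V n) m) a → restrict C (-ᵛ a) ≡ -ᵛ restrict C a
  restrict-neg C a = trans (map-cong (dot-negˡ a) C) (map-∘ -_ (dot F a) C)

  restrict-lincomb : ∀ {n m d} (C : Vec (V n) m) (z : V d) (S : Vec (V n) d) →
                     restrict C (lincomb F z S) ≡ lincomb F z (map (restrict C) S)
  restrict-lincomb C []      []      = restrict-0 C
  restrict-lincomb C (t ∷ z) (s ∷ S) = begin
    restrict C (t · s +ᵛ lincomb F z S)
      ≡⟨ restrict-+ C (t · s) _ ⟩
    restrict C (t · s) +ᵛ restrict C (lincomb F z S)
      ≡⟨ cong₂ _+ᵛ_ (restrict-· C t s) (restrict-lincomb C z S) ⟩
    t · restrict C s +ᵛ lincomb F z (map (restrict C) S) ∎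
    where open ≡-Reasoning

  module _ {n : ℕ} where

    infix 4 _∈Span_ _∈Span?_

    _∈Span_ : ∀ {m} → V n → Vec (V n) m → Set
    x ∈Span C = ∃ λ c → lincomb F c C ≡ x

    _∈Span?_ : ∀ {m} (x : V n) (C : Vec (V n) m) → Dec (x ∈Span C)
    x ∈Span? C = search (allVecs-enumeration _) (λ c → lincomb F c C ≟ᵛ x)

    ∈Span-· : ∀ {m} {C : Vec (V n) m} {x} t → x ∈Span C → t · x ∈Span C
    ∈Span-· {C = C} t (c , refl) = t · c , lincomb-· t c C

    Disjoint : ∀ {m m′} → Vec (V n) m → Vec (V n) m′ → Set
    Disjoint C C′ = ∀ c c′ → lincomb F c C ≡ lincomb F c′ C′ → lincomb F c C ≡ 0ᵛ

    Disjoint-sym : ∀ {m m′} {C : Vec (V n) m} {C′ : Vec (V n) m′} → Disjoint C C′ → Disjoint C′ C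
    Disjoint-sym disjoint c′ c e = trans e (disjoint c c′ (sym e))

    Disjoint-∈Span⇒≡0ᵛ : ∀ {m m′} {C : Vec (V n) m} {C′ : Vec (V n) m′} → Disjoint C C′ →
                            ∀ {x} → x ∈Span C → x ∈Span C′ → x ≡ 0ᵛ
    Disjoint-∈Span⇒≡0ᵛ disjoint (c , refl) (c′ , e′) = disjoint c c′ (sym e′)

    ∉Span⇒Disjoint : ∀ {m} {C : Vec (V n) m} {w} → ¬ w ∈Span C → Disjoint (w ∷ []) C
    ∉Span⇒Disjoint {C = C} {w} w∉C (t ∷ []) c e with t ≟ᶠ 0#
    ... | yes refl = trans (cong (_+ᵛ 0ᵛ) (·-zeroˡ w)) (+ᵛ.identityˡ 0ᵛ)
    ... | no t≢0   = contradiction (inv t t≢0 · c , w≡) w∉C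
      where
      w≡ : lincomb F (inv t t≢0 · c) C ≡ w
      w≡ = trans (lincomb-· _ c C) (sym (·-cancel t≢0 (trans (sym (+ᵛ.identityʳ (t · w))) e)))

    lincomb-injective : ∀ {m} {C : Vec (V n) m} → LinIndep F C →
                        ∀ {z w} → lincomb F z C ≡ lincomb F w C → z ≡ w
    lincomb-injective {C = C} indep {z} {w} e = +ᵛ.x∙y⁻¹≈ε⇒x≈y z w (indep (z +ᵛ -ᵛ w) (begin
      lincomb F (z +ᵛ -ᵛ w) C                   ≡⟨ lincomb-+ z (-ᵛ w) C ⟩
      lincomb F z C +ᵛ lincomb F (-ᵛ w) C       ≡⟨ cong₂ _+ᵛ_ e (lincomb-neg w C) ⟩
      lincomb F w C +ᵛ -ᵛ lincomb F w C         ≡⟨ +ᵛ.inverseʳ _ ⟩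
      0ᵛ                                        ∎))
      where open ≡-Reasoning

    singleton-linIndep : ∀ {w : V n} → w ≢ 0ᵛ → LinIndep F (w ∷ [])
    singleton-linIndep {w} w≢0 (t ∷ []) e with t ≟ᶠ 0#
    ... | yes refl = refl
    ... | no t≢0   =
      contradiction (trans (·-cancel t≢0 (trans (sym (+ᵛ.identityʳ (t · w))) e)) (·-zeroʳ _)) w≢0

    ++-linIndep : ∀ {m m′} {C : Vec (V n) m} {C′ : Vec (V n) m′} →
                  LinIndep F C → LinIndep F C′ → Disjoint C C′ → LinIndep F (C ++ C′)
    ++-linIndep {m} {m′} {C} {C′} indep indep′ disjoint c e with splitAt m c
    ... | z , z′ , refl = begin
      z ++ z′            ≡⟨ cong₂ _++_ (indep z z≡0) (indep′ z′ z′≡0) ⟩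
      0ᵛ {m} ++ 0ᵛ {m′}  ≡⟨ replicate-++ m ⟩
      0ᵛ                 ∎
      where
      open ≡-Reasoning
      sum≡0 : lincomb F z C +ᵛ lincomb F z′ C′ ≡ 0ᵛ
      sum≡0 = trans (sym (lincomb-++ z z′ C C′)) e
      z≡0 : lincomb F z C ≡ 0ᵛ
      z≡0 = disjoint z (-ᵛ z′) (trans (+ᵛ.inverseˡ-unique _ _ sum≡0) (sym (lincomb-neg z′ C′)))
      z′≡0 : lincomb F z′ C′ ≡ 0ᵛ
      z′≡0 = trans (sym (+ᵛ.identityˡ _)) (trans (cong (_+ᵛ lincomb F z′ C′) (sym z≡0)) sum≡0)
      replicate-++ : ∀ k {l} → 0ᵛ {k} ++ 0ᵛ {l} ≡ 0ᵛ
      replicate-++ zero    = refl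
      replicate-++ (suc k) = cong (0# ∷_) (replicate-++ k)

  standardBasis : ∀ m → Vec (V m) m
  standardBasis zero    = []
  standardBasis (suc m) = (1# ∷ 0ᵛ) ∷ map (0# ∷_) (standardBasis m)

  lincomb-0∷ : ∀ {m d} (z : V d) (S : Vec (V m) d) → lincomb F z (map (0# ∷_) S) ≡ 0# ∷ lincomb F z S
  lincomb-0∷ []      []      = refl
  lincomb-0∷ (t ∷ z) (s ∷ S) =
    trans (cong (t · (0# ∷ s) +ᵛ_) (lincomb-0∷ z S))
          (cong (_∷ t · s +ᵛ lincomb F z S) (trans (+-identityʳ _) (zeroʳ t)))

  lincomb-standardBasis : ∀ {m} (z : V m) → lincomb F z (standardBasis m) ≡ z
  lincomb-standardBasis []      = refl
  lincomb-standardBasis (t ∷ z) =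
    trans (cong (t · (1# ∷ 0ᵛ) +ᵛ_) (lincomb-0∷ z (standardBasis _)))
      (cong₂ _∷_ (trans (+-identityʳ _) (*-identityʳ t))
                 (trans (cong₂ _+ᵛ_ (·-zeroʳ t) (lincomb-standardBasis z)) (+ᵛ.identityˡ z)))

  module _ {n : ℕ} where

    restrict-section : ∀ {m} (C : Vec (V n) m) → (∀ y → ∃ λ a → restrict C a ≡ y) →
                       ∃ λ S → ∀ z → restrict C (lincomb F z S) ≡ z
    restrict-section {m} C surjective = S , λ z → begin
      restrict C (lincomb F z S)          ≡⟨ restrict-lincomb C z S ⟩
      lincomb F z (map (restrict C) S)    ≡⟨ cong (lincomb F z) images ⟩
      lincomb F z (standardBasis m)       ≡⟨ lincomb-standardBasis z ⟩
      z                                   ∎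
      where
      open ≡-Reasoning
      S = map (proj₁ ∘ surjective) (standardBasis m)
      images : map (restrict C) S ≡ standardBasis m
      images = trans (sym (map-∘ (restrict C) (proj₁ ∘ surjective) _))
                     (trans (map-cong (proj₂ ∘ surjective) _) (map-id _))

    orthogonal-to-kernel⇒∈Span : ∀ {m} {C S : Vec (V n) m} → (∀ z → restrict C (lincomb F z S) ≡ z) →
                                 ∀ c → (∀ a → restrict C a ≡ 0ᵛ → dot F a c ≡ 0#) → c ∈Span C
    orthogonal-to-kernel⇒∈Span {C = C} {S} section c orthogonal = λs , sym (dot-ext c _ agree)
      where
      λs = map (λ s → dot F s c) S
      agree : ∀ a → dot F a c ≡ dot F a (lincomb F λs C)
      agree a = begin
        dot F a c                             ≡⟨ x∙y⁻¹≈ε⇒x≈y _ _ a-b⊥c ⟩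
        dot F b c                             ≡⟨ dot-lincomb (restrict C a) S c ⟩
        dot F (restrict C a) λs               ≡⟨ dot-comm _ λs ⟩
        dot F λs (map (dot F a) C)            ≡⟨ cong (dot F λs) (map-cong (dot-comm a) C) ⟩
        dot F λs (map (λ c′ → dot F c′ a) C)  ≡⟨ dot-lincomb λs C a ⟨
        dot F (lincomb F λs C) a              ≡⟨ dot-comm _ a ⟩
        dot F a (lincomb F λs C)              ∎
        where
        open ≡-Reasoning
        b = lincomb F (restrict C a) S
        a-b∈kernel : restrict C (a +ᵛ -ᵛ b) ≡ 0ᵛ
        a-b∈kernel = begin
          restrict C (a +ᵛ -ᵛ b)                ≡⟨ restrict-+ C a (-ᵛ b) ⟩
          restrict C a +ᵛ restrict C (-ᵛ b)     ≡⟨ cong (restrict C a +ᵛ_) (restrict-neg C b) ⟩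
          restrict C a +ᵛ -ᵛ restrict C b       ≡⟨ cong (λ r → restrict C a +ᵛ -ᵛ r) (section (restrict C a)) ⟩
          restrict C a +ᵛ -ᵛ restrict C a       ≡⟨ +ᵛ.inverseʳ _ ⟩
          0ᵛ                                    ∎
        a-b⊥c : dot F a c + - dot F b c ≡ 0#
        a-b⊥c = begin
          dot F a c + - dot F b c       ≡⟨ cong (dot F a c +_) (dot-negˡ b c) ⟨
          dot F a c + dot F (-ᵛ b) c    ≡⟨ dot-+ˡ a (-ᵛ b) c ⟨
          dot F (a +ᵛ -ᵛ b) c           ≡⟨ orthogonal (a +ᵛ -ᵛ b) a-b∈kernel ⟩
          0#                            ∎

    linIndep-tail : ∀ {m} {c : V n} {C : Vec (V n) m} → LinIndep F (c ∷ C) → LinIndep F C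
    linIndep-tail {c = c} indep z e =
      ∷-injectiveʳ (indep (0# ∷ z) (trans (cong₂ _+ᵛ_ (·-zeroˡ c) e) (+ᵛ.identityˡ 0ᵛ)))

    linIndep⇒head∉Span : ∀ {m} {c : V n} {C : Vec (V n) m} → LinIndep F (c ∷ C) → ¬ c ∈Span C
    linIndep⇒head∉Span {c = c} indep (λs , e) =
      -1≢0 (∷-injectiveˡ (indep (- 1# ∷ λs) (trans (cong₂ _+ᵛ_ (-1·v≡-ᵛv c) e) (+ᵛ.inverseˡ c))))

    extend-preimage : ∀ {m} {c : V n} {C : Vec (V n) m} {u a y ys} →
                      restrict C u ≡ 0ᵛ → dot F u c ≡ 1# → restrict C a ≡ ys →
                      restrict (c ∷ C) (a +ᵛ (- dot F a c + y) · u) ≡ y ∷ ys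
    extend-preimage {c = c} {C} {u} {a} {y} {ys} u∈kernel u·c≡1 a↦ys = cong₂ _∷_ head tail
      where
      open ≡-Reasoning
      s = - dot F a c + y
      head : dot F (a +ᵛ s · u) c ≡ y
      head = begin
        dot F (a +ᵛ s · u) c          ≡⟨ dot-+ˡ a (s · u) c ⟩
        dot F a c + dot F (s · u) c   ≡⟨ cong (dot F a c +_) (trans (dot-·ˡ s u c) (cong (s *_) u·c≡1)) ⟩
        dot F a c + s * 1#            ≡⟨ cong (dot F a c +_) (*-identityʳ s) ⟩
        dot F a c + (- dot F a c + y) ≡⟨ \\-leftDividesˡ _ y ⟩
        y                             ∎
      tail : restrict C (a +ᵛ s · u) ≡ ys
      tail = begin
        restrict C (a +ᵛ s · u)             ≡⟨ restrict-+ C a (s · u) ⟩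
        restrict C a +ᵛ restrict C (s · u)  ≡⟨ cong₂ _+ᵛ_ a↦ys (restrict-· C s u) ⟩
        ys +ᵛ s · restrict C u              ≡⟨ cong (λ r → ys +ᵛ s · r) u∈kernel ⟩
        ys +ᵛ s · 0ᵛ                        ≡⟨ cong (ys +ᵛ_) (·-zeroʳ s) ⟩
        ys +ᵛ 0ᵛ                            ≡⟨ +ᵛ.identityʳ ys ⟩
        ys                                  ∎

    -- Either some a in the kernel of restrict C has a · c ≢ 0, and rescaling it supplies the new
    -- coordinate, or c is orthogonal to that kernel and hence lies in span C.
    restrict-surjective : ∀ {m} (C : Vec (V n) m) → LinIndep F C → ∀ y → ∃ λ a → restrict C a ≡ y
    restrict-surjective []      _     []       = 0ᵛ , refl
    restrict-surjective (c ∷ C) indep (y ∷ ys)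
      with search (allVecs-enumeration n) (λ a → (restrict C a ≟ᵛ 0ᵛ) ×-dec ¬? (dot F a c ≟ᶠ 0#))
    ... | yes (a₀ , a₀∈kernel , a₀·c≢0) =
      a +ᵛ (- dot F a c + y) · u , extend-preimage {c = c} {C} {u} {a} u∈kernel u·c≡1 a↦ys
      where
      t = inv (dot F a₀ c) a₀·c≢0
      u = t · a₀
      u∈kernel : restrict C u ≡ 0ᵛ
      u∈kernel = trans (restrict-· C t a₀) (trans (cong (t ·_) a₀∈kernel) (·-zeroʳ t))
      u·c≡1 : dot F u c ≡ 1#
      u·c≡1 = trans (dot-·ˡ t a₀ c) (inv-* _ a₀·c≢0)
      preimage = restrict-surjective C (linIndep-tail indep) ys
      a = proj₁ preimage
      a↦ys = proj₂ preimage
    ... | no ¬dual =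
      contradiction (orthogonal-to-kernel⇒∈Span section c orthogonal) (linIndep⇒head∉Span indep)
      where
      section = proj₂ (restrict-section C (restrict-surjective C (linIndep-tail indep)))
      orthogonal : ∀ a → restrict C a ≡ 0ᵛ → dot F a c ≡ 0#
      orthogonal a a∈kernel =
        decidable-stable (dot F a c ≟ᶠ 0#) (λ a·c≢0 → ¬dual (a , a∈kernel , a·c≢0))

module Geometric {q : ℕ} (F : FiniteField q) where
  open import Data.Fin using () renaming (_≟_ to _≟ᶠ_)
  open import Data.List as List using (List; length; allFin)
  open import Data.List.Properties using (map-∘; map-cong; map-cong-local; length-tabulate)
  open import Data.List.Relation.Unary.All as All using (All)
  open import Data.List.Relation.Unary.Any using (Any)
  open import Data.List.Relation.Unary.AllPairs as AllPairs using (AllPairs)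
  import Data.List.Relation.Unary.AllPairs.Properties as AllPairs
  open import Data.Nat using (_∸_) renaming (_+_ to _+ℕ_)
  open import Data.Nat.ListAction using (sum)
  open import Data.Product using (proj₁; proj₂)
  open import Data.Vec using (_++_)
  open import Data.Vec.Properties using (++-injective) renaming (map-++ to mapᵛ-++)
  open import Function using (_∘_; id)
  open import Function.Bundles using (Inverse)
  open import Relation.Binary.PropositionalEquality
    using (_≡_; _≢_; refl; sym; trans; cong; cong₂; module ≡-Reasoning)
  open import Relation.Nullary.Decidable using (_×-dec_)
  open import Relation.Unary using (Decidable)
  open import Relation.Unary.Properties using (∁?; _∩?_)
  open Counting
  open OrthogonalArrays
  open Linear F

  nonzero? : ∀ {n} → Decidable (λ (x : V n) → x ≢ 0ᵛ)
  nonzero? = ∁? (_≟ᵛ 0ᵛ)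

  count-nonzero : ∀ n → count nonzero? (allVecs F n) ≡ q ^ n ∸ 1
  count-nonzero n = cong (_∸ 1) (begin
    1 +ℕ count nonzero? (allVecs F n)
      ≡⟨ cong (_+ℕ count nonzero? (allVecs F n)) (count-unique (allVecs-enumeration n) (_≟ᵛ 0ᵛ) refl id) ⟨
    count (_≟ᵛ 0ᵛ) (allVecs F n) +ℕ count nonzero? (allVecs F n)
      ≡⟨ count+count-∁ (_≟ᵛ 0ᵛ) (allVecs F n) ⟩
    length (allVecs F n)
      ≡⟨ length-allVecs n ⟩
    q ^ n ∎)
    where open ≡-Reasoning

  module _ {n m : ℕ} {C : Vec (V n) m} (indep : LinIndep F C) where

    count-nonzero-∈Span : count (nonzero? ∩? (_∈Span? C)) (allVecs F n) ≡ q ^ m ∸ 1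
    count-nonzero-∈Span = trans
      (sym (count-bijection (allVecs-enumeration m) (allVecs-enumeration n) _≟ᵛ_
             nonzero? (nonzero? ∩? (_∈Span? C)) (λ c → lincomb F c C)
             (λ {c} c≢0 → (λ e → c≢0 (indep c e)) , c , refl)
             (λ _ _ → lincomb-injective indep)
             (λ (x≢0 , c , e) → c , (λ { refl → x≢0 (trans (sym e) (lincomb-0 C)) }) , e)))
      (count-nonzero m)

    count-fibre : ∀ y → count (λ a → restrict C a ≟ᵛ y) (allVecs F n)
                        ≡ count (λ a → restrict C a ≟ᵛ 0ᵛ) (allVecs F n)
    count-fibre y = sym (count-bijection (allVecs-enumeration n) (allVecs-enumeration n) _≟ᵛ_
      (λ a → restrict C a ≟ᵛ 0ᵛ) (λ a → restrict C a ≟ᵛ y) (_+ᵛ u)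
      (λ {a} a∈kernel → trans (restrict-+ C a u) (trans (cong₂ _+ᵛ_ a∈kernel u↦y) (+ᵛ.identityˡ y)))
      (λ _ _ → +ᵛ.∙-cancelʳ u _ _)
      (λ {b} b↦y → b +ᵛ -ᵛ u , b-u∈kernel b b↦y , +ᵛ.//-rightDividesˡ u b))
      where
      u = proj₁ (restrict-surjective C indep y)
      u↦y = proj₂ (restrict-surjective C indep y)
      b-u∈kernel : ∀ b → restrict C b ≡ y → restrict C (b +ᵛ -ᵛ u) ≡ 0ᵛ
      b-u∈kernel b b↦y = begin
        restrict C (b +ᵛ -ᵛ u)             ≡⟨ restrict-+ C b (-ᵛ u) ⟩
        restrict C b +ᵛ restrict C (-ᵛ u)  ≡⟨ cong₂ _+ᵛ_ b↦y (restrict-neg C u) ⟩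
        y +ᵛ -ᵛ restrict C u               ≡⟨ cong (λ r → y +ᵛ -ᵛ r) u↦y ⟩
        y +ᵛ -ᵛ y                          ≡⟨ +ᵛ.inverseʳ y ⟩
        0ᵛ                                 ∎
        where open ≡-Reasoning

  record LabelledBasis (n : ℕ) : Set where
    field
      dim       : ℕ
      basis     : Vec (V n) dim
      levels    : ℕ
      labelling : V dim ↔ Fin levels

  open LabelledBasis

  column : ∀ {n} → LabelledBasis n → Column (V n)
  column D = levels D , λ a → Inverse.to (labelling D) (restrict (basis D) a)

  levels≡q^dim : ∀ {n} (D : LabelledBasis n) → levels D ≡ q ^ dim D
  levels≡q^dim D = begin
    levels D                         ≡⟨ length-tabulate {n = levels D} id ⟨
    length (allFin (levels D))       ≡⟨ length-↔ (allVecs-enumeration (dim D)) (allFin-enumeration (levels D))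
                                          _≟ᶠ_ (labelling D) ⟨
    length (allVecs F (dim D))       ≡⟨ length-allVecs (dim D) ⟩
    q ^ dim D                        ∎
    where open ≡-Reasoning

  column-balanced : ∀ {n} (D D′ : LabelledBasis n) → LinIndep F (basis D ++ basis D′) →
                    Balanced (allVecs F n) (column D) (column D′)
  column-balanced {n} D D′ indep a a′ b b′ =
    trans (as-fibre a b) (trans (count-fibre indep _) (sym (trans (as-fibre a′ b′) (count-fibre indep _))))
    where
    module ℓ  = Inverse (labelling D)
    module ℓ′ = Inverse (labelling D′)
    as-fibre : ∀ a b →
      count (λ r → (proj₂ (column D) r ≟ᶠ a) ×-dec (proj₂ (column D′) r ≟ᶠ b)) (allVecs F n)
        ≡ count (λ r → restrict (basis D ++ basis D′) r ≟ᵛ ℓ.from a ++ ℓ′.from b) (allVecs F n)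
    as-fibre a b = count-≐ _ _
      ((λ {r} (e , e′) → trans (mapᵛ-++ (dot F r) (basis D) (basis D′))
                               (cong₂ _++_ (sym (ℓ.inverseʳ (sym e))) (sym (ℓ′.inverseʳ (sym e′))))) ,
       (λ {r} e → let (e₁ , e₂) = ++-injective _ _ (trans (sym (mapᵛ-++ (dot F r) (basis D) (basis D′))) e)
                  in ℓ.inverseˡ e₁ , ℓ′.inverseˡ e₂))
      (allVecs F n)

  record IsMixedSpread {n : ℕ} (Ds : List (LabelledBasis n)) : Set where
    field
      independent : All (LinIndep F ∘ basis) Ds
      disjoint    : AllPairs (λ D D′ → Disjoint (basis D) (basis D′)) Ds

  Covers : ∀ {n} → List (LabelledBasis n) → Set
  Covers {n} Ds = ∀ (x : V n) → x ≢ 0ᵛ → Any (λ D → x ∈Span basis D) Ds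

  module _ {n : ℕ} {Ds : List (LabelledBasis n)} (spread : IsMixedSpread Ds) where
    open IsMixedSpread spread

    geometric-isOA2 : IsOA2 (allVecs F n) (List.map column Ds)
    geometric-isOA2 = isOA2 (allVecs F n) (AllPairs.map⁺ (AllPairs-mapWithAll
      (λ {D} {D′} indep indep′ disj → column-balanced D D′ (++-linIndep indep indep′ disj))
      independent disjoint))

    geometric-tight : Covers Ds → Tight (q ^ n) (List.map column Ds)
    geometric-tight covers = begin
      sum (List.map (λ c → proj₁ c ∸ 1) (List.map column Ds))
        ≡⟨ cong sum (map-∘ Ds) ⟨
      sum (List.map (λ D → levels D ∸ 1) Ds)
        ≡⟨ cong sum (map-cong (λ D → cong (_∸ 1) (levels≡q^dim D)) Ds) ⟩
      sum (List.map (λ D → q ^ dim D ∸ 1) Ds)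
        ≡⟨ cong sum (map-cong-local (All.map (sym ∘ count-nonzero-∈Span) independent)) ⟩
      sum (List.map (λ D → count (nonzero? ∩? (_∈Span? basis D)) (allVecs F n)) Ds)
        ≡⟨ double-count nonzero? (λ x D → x ∈Span? basis D) Ds in-exactly-one (allVecs F n) ⟨
      count nonzero? (allVecs F n)
        ≡⟨ count-nonzero n ⟩
      q ^ n ∸ 1 ∎
      where
      open ≡-Reasoning
      in-exactly-one : ∀ {x} → x ≢ 0ᵛ → count (λ D → x ∈Span? basis D) Ds ≡ 1
      in-exactly-one {x} x≢0 = count-one (λ D → x ∈Span? basis D) (covers x x≢0)
        (AllPairs.map (λ disj (x∈D , x∈D′) → x≢0 (Disjoint-∈Span⇒≡0ᵛ disj x∈D x∈D′)) disjoint)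

module MonicVectors {q : ℕ} (F : FiniteField q) where
  open import Algebra.Bundles using (CommutativeRing)
  open import Data.Fin using () renaming (_≟_ to _≟ᶠ_)
  open import Data.Product using (∃₂; proj₂)
  open import Data.Vec using ([]; _∷_)
  open import Data.Vec.Properties using (∷-injectiveˡ; ∷-injectiveʳ)
  open import Function using (_∘_)
  open import Relation.Binary.PropositionalEquality
    using (_≡_; _≢_; refl; sym; trans; cong; cong₂; module ≡-Reasoning)
  open import Relation.Nullary using (yes; no; contradiction)
  open import Relation.Unary using (Decidable)
  open Linear F
  open FiniteField F using (_*_; 0#; 1#; 0≢1; inverse)
  open CommutativeRing commutativeRing using (*-identityʳ; zeroʳ)

  -- Monic vectors represent the points of the projective space over F.
  data Monic : ∀ {n} → V n → Set where
    leading-one  : ∀ {n x} {v : V n} → x ≡ 1# → Monic (x ∷ v)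
    leading-zero : ∀ {n x} {v : V n} → x ≡ 0# → Monic v → Monic (x ∷ v)

  monic? : ∀ {n} → Decidable (Monic {n})
  monic? []      = no λ ()
  monic? (x ∷ v) with x ≟ᶠ 1# | x ≟ᶠ 0# | monic? v
  ... | yes x≡1 | _       | _      = yes (leading-one x≡1)
  ... | no x≢1  | yes x≡0 | yes mv = yes (leading-zero x≡0 mv)
  ... | no x≢1  | yes _   | no ¬mv = no λ { (leading-one x≡1) → x≢1 x≡1 ; (leading-zero _ mv) → ¬mv mv }
  ... | no x≢1  | no x≢0  | _      = no λ { (leading-one x≡1) → x≢1 x≡1 ; (leading-zero x≡0 _) → x≢0 x≡0 }

  monic⇒nonzero : ∀ {n} {w : V n} → Monic w → w ≢ 0ᵛ
  monic⇒nonzero (leading-one x≡1)   e = 0≢1 (trans (sym (∷-injectiveˡ e)) x≡1)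
  monic⇒nonzero (leading-zero _ mv) e = monic⇒nonzero mv (∷-injectiveʳ e)

  monic-proportional⇒≡ : ∀ {n t} {w w′ : V n} → Monic w → Monic w′ → w ≡ t · w′ → w ≡ w′
  monic-proportional⇒≡ {t = t} (leading-one x≡1) (leading-one x′≡1) e = cong₂ _∷_ (trans x≡1 (sym x′≡1)) (begin
    _                  ≡⟨ ∷-injectiveʳ e ⟩
    t · _              ≡⟨ cong (_· _) t≡1 ⟩
    1# · _             ≡⟨ ·-identityˡ _ ⟩
    _                  ∎)
    where
    open ≡-Reasoning
    t≡1 : t ≡ 1#
    t≡1 = trans (sym (*-identityʳ t)) (trans (cong (t *_) (sym x′≡1)) (trans (sym (∷-injectiveˡ e)) x≡1))
  monic-proportional⇒≡ {t = t} (leading-one x≡1) (leading-zero x′≡0 _) e =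
    contradiction (trans (sym (trans (∷-injectiveˡ e) (trans (cong (t *_) x′≡0) (zeroʳ t)))) x≡1) 0≢1
  monic-proportional⇒≡ {t = t} (leading-zero x≡0 mv) (leading-one x′≡1) e =
    contradiction (trans (∷-injectiveʳ e) (trans (cong (_· _) t≡0) (·-zeroˡ _))) (monic⇒nonzero mv)
    where
    t≡0 : t ≡ 0#
    t≡0 = trans (sym (*-identityʳ t)) (trans (cong (t *_) (sym x′≡1)) (trans (sym (∷-injectiveˡ e)) x≡0))
  monic-proportional⇒≡ (leading-zero x≡0 mv) (leading-zero x′≡0 mv′) e =
    cong₂ _∷_ (trans x≡0 (sym x′≡0)) (monic-proportional⇒≡ mv mv′ (∷-injectiveʳ e))

  monic-decomposition : ∀ {n} (x : V n) → x ≢ 0ᵛ → ∃₂ λ t w → Monic w × x ≡ t · w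
  monic-decomposition []      []≢0 = contradiction refl []≢0
  monic-decomposition (x ∷ v) x∷v≢0 with x ≟ᶠ 0#
  ... | yes refl = let (t , w , mw , v≡tw) = monic-decomposition v (x∷v≢0 ∘ cong (0# ∷_)) in
    t , 0# ∷ w , leading-zero refl mw , cong₂ _∷_ (sym (zeroʳ t)) v≡tw
  ... | no x≢0   = x , 1# ∷ inv x x≢0 · v , leading-one refl ,
    cong₂ _∷_ (sym (*-identityʳ x)) (begin
      v                      ≡⟨ ·-identityˡ v ⟨
      1# · v                 ≡⟨ cong (_· v) (proj₂ (inverse x x≢0)) ⟨
      (x * inv x x≢0) · v    ≡⟨ ·-assoc x _ v ⟨
      x · inv x x≢0 · v      ∎)
    where open ≡-Reasoning

module Completion {q : ℕ} (F : FiniteField q) (n k : ℕ) (d : Fin k → ℕ)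
                  (B : (i : Fin k) → Vec (Vec (Fin q) n) (d i))
                  (ℓ : (i : Fin k) → Vec (Fin q) (d i) ↔ Fin (q ^ d i)) where
  open import Data.List as List using (List; filter; allFin)
  open import Data.List.Properties using (map-∘; map-++)
  open import Data.List.Membership.Propositional using (_∈_; lose)
  open import Data.List.Membership.Propositional.Properties using (∈-allFin; ∈-filter⁺)
  open import Data.List.Relation.Unary.All as All using (All)
  import Data.List.Relation.Unary.All.Properties as All
  import Data.List.Relation.Unary.Any.Properties as Any
  open import Data.List.Relation.Unary.AllPairs as AllPairs using ()
  import Data.List.Relation.Unary.AllPairs.Properties as AllPairs
  open import Data.List.Relation.Unary.Unique.Propositional.Properties using (allFin⁺; filter⁺)
  open import Data.Product using (∃; proj₁; proj₂)
  open import Data.Vec using ([]; _∷_; head; [_])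
  open import Function using (_∘_)
  open import Function.Bundles using (mk↔ₛ′)
  open import Relation.Binary.PropositionalEquality using (_≡_; _≢_; refl; sym; trans; cong₂; subst)
  open import Relation.Nullary using (¬_; yes; no)
  open import Relation.Nullary.Decidable using (¬?)
  open import Relation.Unary using (Decidable)
  open import Relation.Unary.Properties using (_∩?_)
  open Counting
  open Linear F
  open Geometric F
  open MonicVectors F
  open LabelledBasis

  Uncovered : V n → Set
  Uncovered x = ¬ ∃ λ i → x ∈Span B i

  uncovered? : Decidable Uncovered
  uncovered? x = ¬? (search (allFin-enumeration k) (λ i → x ∈Span? B i))

  points : List (V n)
  points = filter (monic? ∩? uncovered?) (allVecs F n)

  spreadBasis : Fin k → LabelledBasis n
  spreadBasis i = record { dim = d i ; basis = B i ; levels = q ^ d i ; labelling = ℓ i }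

  pointBasis : V n → LabelledBasis n
  pointBasis w = record { dim = 1 ; basis = [ w ] ; levels = q
                        ; labelling = mk↔ₛ′ head [_] (λ _ → refl) (λ { (_ ∷ []) → refl }) }

  bases : List (LabelledBasis n)
  bases = List.map spreadBasis (allFin k) List.++ List.map pointBasis points

  pointFunctionals : List (V n → Fin q)
  pointFunctionals = List.map (λ w a → dot F a w) points

  columns≡geomOA++points : List.map column bases ≡ geomOA F n k d B ℓ List.++ List.map (q ,_) pointFunctionals
  columns≡geomOA++points = trans (map-++ column (List.map spreadBasis (allFin k)) _)
    (cong₂ List._++_ (sym (map-∘ (allFin k))) (trans (sym (map-∘ points)) (map-∘ points)))

  points-monic-uncovered : All (λ w → Monic w × Uncovered w) points
  points-monic-uncovered = All.all-filter (monic? ∩? uncovered?) (allVecs F n)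

  monic-disjoint : ∀ {w w′ : V n} → Monic w → Monic w′ → w ≢ w′ → Disjoint [ w ] [ w′ ]
  monic-disjoint {w} mw mw′ w≢w′ = ∉Span⇒Disjoint λ where
    (t ∷ [] , e) → w≢w′ (monic-proportional⇒≡ mw mw′ (trans (sym e) (+ᵛ.identityʳ (t · _))))

  module _ (indep : ∀ i → LinIndep F (B i)) (spread : MixedSpread F d B) where

    bases-isMixedSpread : IsMixedSpread bases
    bases-isMixedSpread = record
      { independent = All.++⁺
          (All.map⁺ (All.universal indep (allFin k)))
          (All.map⁺ (All.map (singleton-linIndep ∘ monic⇒nonzero ∘ proj₁) points-monic-uncovered))
      ; disjoint = AllPairs.++⁺
          (AllPairs.map⁺ (AllPairs.map (spread _ _) (allFin⁺ k)))
          (AllPairs.map⁺ (AllPairs-mapWithAll (λ (mw , _) (mw′ , _) → monic-disjoint mw mw′)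
            points-monic-uncovered (filter⁺ (monic? ∩? uncovered?) (Enumeration.unique (allVecs-enumeration n)))))
          (All.map⁺ (All.universal (λ i → All.map⁺ (All.map
            (λ (_ , uncovered) → Disjoint-sym (∉Span⇒Disjoint (λ w∈Bi → uncovered (i , w∈Bi))))
            points-monic-uncovered)) (allFin k)))
      }

  bases-cover : Covers bases
  bases-cover x x≢0 with search (allFin-enumeration k) (λ i → x ∈Span? B i)
  ... | yes (i , x∈Bi) = Any.++⁺ˡ (Any.map⁺ (lose (∈-allFin i) x∈Bi))
  ... | no uncovered   =
    Any.++⁺ʳ _ (Any.map⁺ (lose w∈points (t ∷ [] , trans (+ᵛ.identityʳ (t · w)) (sym x≡tw))))
    where
    decomposition = monic-decomposition x x≢0
    t = proj₁ decomposition
    w = proj₁ (proj₂ decomposition)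
    mw = proj₁ (proj₂ (proj₂ decomposition))
    x≡tw = proj₂ (proj₂ (proj₂ decomposition))
    w∈points : w ∈ points
    w∈points = ∈-filter⁺ (monic? ∩? uncovered?) (Enumeration.complete (allVecs-enumeration n) w)
      (mw , λ (i , w∈Bi) → uncovered (i , subst (_∈Span B i) (sym x≡tw) (∈Span-· t w∈Bi)))

open import Data.List using (List; _++_; map)
open import Relation.Binary.PropositionalEquality using (subst)

lemma6 : ∀ {q : ℕ} (F : FiniteField q) (n k : ℕ) (d : Fin k → ℕ)
           (B : (i : Fin k) → Vec (Vec (Fin q) n) (d i)) →
           (∀ i → LinIndep F (B i)) →
           MixedSpread F d B →
           (ℓ : (i : Fin k) → Vec (Fin q) (d i) ↔ Fin (q ^ d i)) →
           Σ (List (Vec (Fin q) n → Fin q)) λ gs →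
             IsOA2 (allVecs F n) (geomOA F n k d B ℓ ++ map (λ g → q , g) gs)
             × Tight (q ^ n) (geomOA F n k d B ℓ ++ map (λ g → q , g) gs)
lemma6 {q} F n k d B indep spread ℓ =
  pointFunctionals ,
  subst (IsOA2 (allVecs F n)) columns≡geomOA++points (geometric-isOA2 isMixedSpread) ,
  subst (Tight (q ^ n)) columns≡geomOA++points (geometric-tight isMixedSpread bases-cover)
  where
  open Geometric F
  open Completion F n k d B ℓ
  isMixedSpread = bases-isMixedSpread indep spread
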